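{- Let $\ell\ge 1$ and let $x=(x_1,\ldots,x_n)\in[\ell]^n$ be a minimal non-crossing sequence. Then $n\le 4\ell$.
   Context: $[\ell]=\{1,\ldots,\ell\}$. A sequence $x\in[\ell]^n$ is non-crossing if for all $1\le i<j<k<l\le n$ we have $x_i\neq x_k$, or $x_j\neq x_l$, or $x_i,x_j,x_k,x_l$ are all equal. It is minimal if there is no index $i$ with $x_i=x_{i+1}=x_{i+2}$. -}

module Defs where

open import Data.Nat using (ℕ; suc; _+_; _<_)
open import Data.Fin using (Fin; toℕ)
open import Data.Product using (_×_)
open import Data.Sum using (_⊎_)
open import Relation.Binary.PropositionalEquality using (_≡_; _≢_)
open import Relation.Nullary using (¬_)

-- A sequence x ∈ [ℓ]^n is a function Fin n → Fin ℓ (position i ↦ x_i).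
-- Positions 0..n-1 stand for 1..n, values Fin ℓ stand for [ℓ] = {1..ℓ}.

NonCrossing : ∀ {ℓ n} → (Fin n → Fin ℓ) → Set
NonCrossing {ℓ} {n} x =
  ∀ (i j k l : Fin n) → toℕ i < toℕ j → toℕ j < toℕ k → toℕ k < toℕ l →
    x i ≢ x k ⊎ x j ≢ x l ⊎ (x i ≡ x j × x j ≡ x k × x k ≡ x l)

Minimal : ∀ {ℓ n} → (Fin n → Fin ℓ) → Set
Minimal {ℓ} {n} x =
  ∀ (i j k : Fin n) → toℕ j ≡ suc (toℕ i) → toℕ k ≡ suc (toℕ j) →
    ¬ (x i ≡ x j × x j ≡ x k)

module Submission where

-- Since no letter occurs three times in a row, x splits into maximal runs of
-- length one or two; call the first position of a run a run start.  We injectively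
-- encode every position i by a letter and two bits:
--   * i ↦ (s, b): s is the run start of i and b says whether i = s or i = s + 1;
--   * s ↦ (a, t) for a run start s: if x_s occurs for the first time at s, then
--     (a, t) = (x_s, 0); otherwise (a, t) = (x_{s-1}, 1).  For the second, two first
-- occurrences carry distinct letters, and two recurring run starts s < s' with
-- x_{s-1} = x_{s'-1} would give an earlier p with x_p = x_s and the pattern
-- p < s-1 < s < s'-1, which is a crossing.  Hence i ↦ (a, t, b) is an injection
-- into [ℓ] × 2 × 2, and n ≤ 4ℓ by counting.

open import Defs
open import Data.Nat using (ℕ; _≤_; _*_)
open import Data.Fin using (Fin)

open import Data.Nat as ℕ using (suc; _<_; z≤n)
import Data.Nat.Properties as ℕ
open import Data.Fin as Fin using (toℕ; inject₁; combine)
open import Data.Fin.Patterns using (0F; 1F)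
open import Data.Fin.Properties
  using (toℕ-injective; toℕ-inject₁; any?; _≟_; <-cmp; injective⇒≤; combine-injective)
open import Data.Product using (_×_; _,_; proj₁; proj₂; ∃; ∃₂)
open import Data.Product.Properties using (,-injective)
open import Data.Sum using (inj₁; inj₂)
open import Data.Empty using (⊥-elim)
open import Function using (_∘_)
open import Function.Definitions using (Injective)
open import Relation.Binary using (tri<; tri≈; tri>)
open import Relation.Binary.PropositionalEquality
  using (_≡_; _≢_; refl; sym; trans; cong; subst; subst₂)
open import Relation.Nullary using (¬_; Dec; yes; no)
open import Relation.Nullary.Decidable using (_×-dec_)

pairs-injective⇒≤ : ∀ {n a b} (f : Fin n → Fin a × Fin b) →
                    Injective _≡_ _≡_ f → n ≤ a * b
pairs-injective⇒≤ {a = a} {b} f f-inj =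
  injective⇒≤ (f-inj ∘ pair-≡ ∘ combine-injective _ _ _ _)
  where
  pair-≡ : ∀ {p q : Fin a × Fin b} → proj₁ p ≡ proj₁ q × proj₂ p ≡ proj₂ q → p ≡ q
  pair-≡ (refl , refl) = refl

symmetric-increasing-free⇒≡ : ∀ {n} (R : Fin n → Fin n → Set) →
  (∀ {s s'} → R s s' → R s' s) → (∀ {s s'} → toℕ s < toℕ s' → ¬ R s s') →
  ∀ {s s'} → R s s' → s ≡ s'
symmetric-increasing-free⇒≡ R sym-R free {s} {s'} r with <-cmp s s'
... | tri< s<s' _ _ = ⊥-elim (free s<s' r)
... | tri≈ _ s≡s' _ = s≡s'
... | tri> _ _ s'<s = ⊥-elim (free s'<s (sym-R r))

_⋖_ : ∀ {n} → Fin n → Fin n → Set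
j ⋖ i = suc (toℕ j) ≡ toℕ i

⋖-injectiveʳ : ∀ {n} {j i i' : Fin n} → j ⋖ i → j ⋖ i' → i ≡ i'
⋖-injectiveʳ j⋖i j⋖i' = toℕ-injective (trans (sym j⋖i) j⋖i')

predecessor : ∀ {n} (i : Fin n) → 0 < toℕ i → ∃ λ j → j ⋖ i
predecessor (Fin.suc i) _ = inject₁ i , cong suc (toℕ-inject₁ i)

module _ {ℓ n : ℕ} (x : Fin n → Fin ℓ) where

  ContinuesRun : Fin n → Set
  ContinuesRun i = ∃ λ j → j ⋖ i × x j ≡ x i

  continuesRun? : ∀ i → Dec (ContinuesRun i)
  continuesRun? i = any? λ j → (suc (toℕ j) ℕ.≟ toℕ i) ×-dec (x j ≟ x i)

  RunStart : Fin n → Set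
  RunStart i = ¬ ContinuesRun i

  Recurs : Fin n → Set
  Recurs i = ∃ λ p → toℕ p < toℕ i × x p ≡ x i

  recurs? : ∀ i → Dec (Recurs i)
  recurs? i = any? λ p → (toℕ p ℕ.<? toℕ i) ×-dec (x p ≟ x i)

  data RunStartOf (i : Fin n) : Fin n → Fin 2 → Set where
    itself   : RunStart i → RunStartOf i i 0F
    previous : ∀ {j} → j ⋖ i → x j ≡ x i → RunStartOf i j 1F

  runStartOf : ∀ i → ∃₂ (RunStartOf i)
  runStartOf i with continuesRun? i
  ... | yes (j , j⋖i , xj≡xi) = j , 1F , previous j⋖i xj≡xi
  ... | no start              = i , 0F , itself start

  runStartOf-injective : ∀ {i i' s b} → RunStartOf i s b → RunStartOf i' s b → i ≡ i'
  runStartOf-injective (itself _)       (itself _)         = refl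
  runStartOf-injective (previous s⋖i _) (previous s⋖i' _) = ⋖-injectiveʳ s⋖i s⋖i'

  data Label (s : Fin n) (a : Fin ℓ) : Fin 2 → Set where
    fresh     : ¬ Recurs s → a ≡ x s → Label s a 0F
    recurring : ∀ {j} → Recurs s → j ⋖ s → a ≡ x j → Label s a 1F

  label : ∀ s → ∃₂ (Label s)
  label s with recurs? s
  ... | no first = x s , 0F , fresh first refl
  ... | yes recurs@(p , p<s , _) with predecessor s (ℕ.≤-<-trans z≤n p<s)
  ...   | j , j⋖s = x j , 1F , recurring recurs j⋖s refl

  module _ (minimal : Minimal x) where

    -- By minimality, the run containing i starts at i or at its predecessor.
    runStartOf-start : ∀ {i s b} → RunStartOf i s b → RunStart s
    runStartOf-start (itself start) = start
    runStartOf-start {i} (previous {j} j⋖i xj≡xi) (k , k⋖j , xk≡xj) =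
      minimal k j i (sym k⋖j) (sym j⋖i) (xk≡xj , xj≡xi)

  module _ (nonCrossing : NonCrossing x) where

    -- Core crossing argument: recurring run starts s < s' have distinct
    -- preceding letters, for otherwise p < s-1 < s < s'-1 with x_p = x_s.
    recurring-predecessors-distinct :
      ∀ {s s' j j'} → toℕ s < toℕ s' → RunStart s → Recurs s →
      j ⋖ s → j' ⋖ s' → x j ≢ x j'
    recurring-predecessors-distinct {s} {s'} {j} {j'} s<s' start (p , p<s , xp≡xs) j⋖s j'⋖s' xj≡xj'
      with nonCrossing p j s j' p<j j<s s<j'
      where
      p<j : toℕ p < toℕ j
      p<j = ℕ.≤∧≢⇒< (ℕ.≤-pred (subst (toℕ p <_) (sym j⋖s) p<s))
                     λ p≡j → start (p , subst (_⋖ s) (sym (toℕ-injective p≡j)) j⋖s , xp≡xs)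
      j<s : toℕ j < toℕ s
      j<s = subst (toℕ j <_) j⋖s (ℕ.n<1+n (toℕ j))
      s<j' : toℕ s < toℕ j'
      s<j' = ℕ.≤∧≢⇒< (ℕ.≤-pred (subst (toℕ s <_) (sym j'⋖s') s<s'))
                      λ s≡j' → start (j , j⋖s , trans xj≡xj' (cong x (sym (toℕ-injective s≡j'))))
    ... | inj₁ xp≢xs                 = xp≢xs xp≡xs
    ... | inj₂ (inj₁ xj≢xj')         = xj≢xj' xj≡xj'
    ... | inj₂ (inj₂ (xp≡xj , _ , _)) = start (j , j⋖s , trans (sym xp≡xj) xp≡xs)

    label-injective : ∀ {s s' a t} → RunStart s → RunStart s' →
                      Label s a t → Label s' a t → s ≡ s'
    label-injective {a = a} {t} start start' lab lab' =
      symmetric-increasing-free⇒≡ SameLabel swap increasing-free (a , t , start , start' , lab , lab')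
      where
      SameLabel : Fin n → Fin n → Set
      SameLabel s s' = ∃₂ λ a t → RunStart s × RunStart s' × Label s a t × Label s' a t

      swap : ∀ {s s'} → SameLabel s s' → SameLabel s' s
      swap (a , t , st , st' , l , l') = a , t , st' , st , l' , l

      increasing-free : ∀ {s s'} → toℕ s < toℕ s' → ¬ SameLabel s s'
      increasing-free s<s' (_ , _ , _ , _ , fresh _ a≡xs , fresh first' a≡xs') =
        first' (_ , s<s' , trans (sym a≡xs) a≡xs')
      increasing-free s<s' (_ , _ , st , _ , recurring recurs j⋖s a≡xj , recurring _ j'⋖s' a≡xj') =
        recurring-predecessors-distinct s<s' st recurs j⋖s j'⋖s' (trans (sym a≡xj) a≡xj')

  module _ (nonCrossing : NonCrossing x) (minimal : Minimal x) where

    head : Fin n → Fin n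
    head i = proj₁ (runStartOf i)

    offset : Fin n → Fin 2
    offset i = proj₁ (proj₂ (runStartOf i))

    head-spec : ∀ i → RunStartOf i (head i) (offset i)
    head-spec i = proj₂ (proj₂ (runStartOf i))

    letter : Fin n → Fin ℓ
    letter i = proj₁ (label (head i))

    kind : Fin n → Fin 2
    kind i = proj₁ (proj₂ (label (head i)))

    label-spec : ∀ i → Label (head i) (letter i) (kind i)
    label-spec i = proj₂ (proj₂ (label (head i)))

    encode : Fin n → Fin ℓ × Fin (2 * 2)
    encode i = letter i , combine (kind i) (offset i)

    encode-injective : Injective _≡_ _≡_ encode
    encode-injective {i} {i'} encode≡
      with a≡a' , tb≡t'b' ← ,-injective encode≡
      with t≡t' , b≡b' ← combine-injective (kind i) (offset i) (kind i') (offset i') tb≡t'b'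
      = runStartOf-injective (head-spec i) (subst₂ (RunStartOf i') (sym s≡s') (sym b≡b') (head-spec i'))
      where
      s≡s' : head i ≡ head i'
      s≡s' = label-injective nonCrossing
        (runStartOf-start minimal (head-spec i)) (runStartOf-start minimal (head-spec i'))
        (label-spec i) (subst₂ (Label (head i')) (sym a≡a') (sym t≡t') (label-spec i'))

lemma4 : (ℓ n : ℕ) → 1 ≤ ℓ → (x : Fin n → Fin ℓ) →
    NonCrossing x → Minimal x → n ≤ 4 * ℓ
lemma4 ℓ n _ x nonCrossing minimal =
  subst (n ≤_) (ℕ.*-comm ℓ 4) (pairs-injective⇒≤ (encode x nonCrossing minimal)
                                                  (encode-injective x nonCrossing minimal))
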